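{- Let $k\geq 3$, $g=2s\geq 4$, and $\epsilon$ be integers with $0<\epsilon<k-1$. Then there is no integer $n$ such that a $vgr(n,k,g,nc(k,g)-\epsilon)$-graph exists, where $nc(k,g)=\frac{k(k-1)^s}{2}$.
   Context: A $vgr(n,k,g,\lambda)$-graph is a $k$-regular graph of girth $g$ on $n$ vertices in which every vertex is contained in exactly $\lambda$ cycles of length $g$. -}

module Defs where

open import Data.Nat using (ℕ; zero; suc; _+_; _*_; _∸_; _^_; _≤_; _<_; _<ᵇ_)
open import Data.Nat.DivMod using (_/_)
open import Data.Bool using (Bool; true; false; _∧_; not; if_then_else_)
open import Data.Fin using (Fin; toℕ; _≟_)
open import Data.List using (List; []; _∷_; map; concatMap; length; filterᵇ; allFin)
open import Data.Bool.ListAction using (any)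
open import Data.Product using (Σ; _×_; ∃-syntax)
open import Relation.Nullary.Decidable using (⌊_⌋)
open import Relation.Binary.PropositionalEquality using (_≡_)
open import Relation.Nullary using (¬_)

record Graph (n : ℕ) : Set where
  field
    adj   : Fin n → Fin n → Bool
    sym   : ∀ u v → adj u v ≡ adj v u
    irrfl : ∀ v → adj v v ≡ false
open Graph public

allLists : (n m : ℕ) → List (List (Fin n))
allLists n zero    = [] ∷ []
allLists n (suc m) = concatMap (λ x → map (x ∷_) (allLists n m)) (allFin n)

count : {A : Set} → (A → Bool) → List A → ℕ
count p xs = length (filterᵇ p xs)

degree : ∀ {n} → Graph n → Fin n → ℕ
degree {n} G v = count (adj G v) (allFin n)

Regular : ∀ {n} → Graph n → ℕ → Set
Regular G k = ∀ v → degree G v ≡ k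

distinct : ∀ {n} → List (Fin n) → Bool
distinct []       = true
distinct (x ∷ xs) = not (any (λ y → ⌊ x ≟ y ⌋) xs) ∧ distinct xs

pathClose : ∀ {n} → Graph n → Fin n → List (Fin n) → Bool
pathClose G x0 []           = false
pathClose G x0 (x ∷ [])     = adj G x x0
pathClose G x0 (x ∷ y ∷ xs) = adj G x y ∧ pathClose G x0 (y ∷ xs)

isCycleSeq : ∀ {n} → Graph n → List (Fin n) → Bool
isCycleSeq G []               = false
isCycleSeq G (x ∷ [])         = false
isCycleSeq G (x ∷ y ∷ [])     = false
isCycleSeq G (x ∷ y ∷ z ∷ xs) = distinct (x ∷ y ∷ z ∷ xs) ∧ pathClose G x (x ∷ y ∷ z ∷ xs)

lastOr : ∀ {n} → Fin n → List (Fin n) → Fin n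
lastOr d []       = d
lastOr d (x ∷ xs) = lastOr x xs

-- canonical representative of a cycle through v:  v = v0, and toℕ v1 < toℕ v_{m-1}
-- (fixes the starting vertex and the orientation, so each cycle through v is
-- represented by exactly one sequence)
isCanonicalCycleAt : ∀ {n} → Graph n → Fin n → List (Fin n) → Bool
isCanonicalCycleAt G v (x ∷ y ∷ xs) =
  ⌊ x ≟ v ⌋ ∧ isCycleSeq G (x ∷ y ∷ xs) ∧ (toℕ y <ᵇ toℕ (lastOr y xs))
isCanonicalCycleAt G v _ = false

cyclesThrough : ∀ {n} → Graph n → ℕ → Fin n → ℕ
cyclesThrough {n} G m v = count (isCanonicalCycleAt G v) (allLists n m)

HasCycle : ∀ {n} → Graph n → ℕ → Set
HasCycle {n} G m = Σ (List (Fin n)) λ xs → (length xs ≡ m) × (isCycleSeq G xs ≡ true)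

Girth : ∀ {n} → Graph n → ℕ → Set
Girth G g = HasCycle G g × (∀ m → m < g → ¬ HasCycle G m)

IsVGR : ∀ {n} → Graph n → (k g λ' : ℕ) → Set
IsVGR G k g λ' = Regular G k × Girth G g × (∀ v → cyclesThrough G g v ≡ λ')

-- nc(k,g) for g = 2s :  k (k-1)^s / 2
nc : (k s : ℕ) → ℕ
nc k s = (k * (k ∸ 1) ^ s) / 2

-- Fix a vertex v and let d(w) be the number of non-backtracking walks with s edges from w to v.
-- There are k(k-1)^(s-1) such walks in all, and as the girth is 2s two of them leaving w along the
-- same edge coincide, so d(w) ≤ k. Two of them leaving w along different edges close up to a
-- g-cycle through v, and every g-cycle through v arises twice in this way, so 2λ = Σ d(d-1).
-- Hence the defect D = Σ d(k-d) equals k(k-1)^s - 2λ, and λ = nc(k,g) - ε gives 0 < D < 2(k-1).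
-- But a term d(k-d) is 0 when d ∈ {0,k} and at least k-1 otherwise, so exactly one d(w) is not
-- a multiple of k, although Σ d(w) is.

module Submission where

open import Defs hiding (sym)
open Defs using () renaming (sym to adj-sym)
open import Data.Nat using (ℕ; zero; suc; _+_; _*_; _∸_; _^_; _≤_; _<_; z≤n; s≤s; z<s; >-nonZero)
open import Data.Nat.Properties hiding (_≟_)
import Data.Nat.Properties as ℕ
open import Data.Nat.ListAction using (sum)
open import Data.Nat.Divisibility
  using (_∣_; _∣0; ∣-refl; ∣⇒≤; ∣m∣n⇒∣m+n; ∣m+n∣m⇒∣n; m∣m*n)
open import Data.Nat.DivMod using (_/_; _%_; m≡m%n+[m/n]*n; m%n<n)
open import Data.Nat.Tactic.RingSolver using (solve-∀)
open import Data.Fin using (Fin; _≟_; toℕ)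
open import Data.Fin.Properties using (toℕ-injective)
open import Data.List using (List; []; _∷_; _++_; _∷ʳ_; map; concatMap; length; reverse; allFin)
open import Data.List.Properties
  using ( unfold-reverse; reverse-++; reverse-involutive; ++-assoc; length-++; length-reverse
        ; ∷-injective; ∷-injectiveʳ)
open import Data.List.Membership.Propositional using (_∈_)
open import Data.List.Membership.Propositional.Properties
  using (∈-map⁺; ∈-map⁻; ∈-concat⁺′; ∈-concat⁻′; ∈-allFin; ∈-∃++)
open import Data.List.Relation.Unary.All as All using (All; []; _∷_)
import Data.List.Relation.Unary.All.Properties as Allₚ
open import Data.List.Relation.Unary.Any using (here; there; any?)
open import Data.List.Relation.Unary.AllPairs as AllPairs using ([]; _∷_)
import Data.List.Relation.Unary.AllPairs.Properties as AllPairsₚ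
open import Data.List.Relation.Unary.Unique.Propositional using (Unique)
import Data.List.Relation.Unary.Unique.Propositional.Properties as Uniqueₚ
open import Data.List.Relation.Binary.Disjoint.Propositional using (Disjoint)
open import Data.Bool using (Bool; true; false; T; _∧_)
open import Data.Bool.ListAction using (any)
import Data.Bool.Properties as Bool
open import Data.Product using (Σ; _×_; _,_; proj₁; proj₂; map₁; ∃₂)
open import Data.Sum using (_⊎_; inj₁; inj₂)
open import Data.Unit using (⊤; tt)
open import Data.Empty using (⊥; ⊥-elim)
open import Function using (_∘_; id)
open import Function.Bundles using (Equivalence)
open import Relation.Binary.PropositionalEquality
open import Relation.Nullary using (¬_; yes; no; Dec)
open import Relation.Nullary.Decidable using (_×-dec_; ¬?; ⌊_⌋; toWitness; fromWitness)
open import Algebra.Properties.CommutativeSemigroup +-commutativeSemigroup using (interchange)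
open import Algebra.Properties.CommutativeSemigroup *-commutativeSemigroup using (x∙yz≈y∙xz)

-- Finite sums

∑ : {A : Set} → List A → (A → ℕ) → ℕ
∑ L f = sum (map f L)

infixr 5 ∑
syntax ∑ L (λ x → e) = ∑[ x ← L ] e

private variable A B : Set

∑-cong-∈ : ∀ L {f g : A → ℕ} → (∀ {x} → x ∈ L → f x ≡ g x) → ∑ L f ≡ ∑ L g
∑-cong-∈ []      e = refl
∑-cong-∈ (x ∷ L) e = cong₂ _+_ (e (here refl)) (∑-cong-∈ L (e ∘ there))

∑-cong : ∀ L {f g : A → ℕ} → (∀ x → f x ≡ g x) → ∑ L f ≡ ∑ L g
∑-cong L e = ∑-cong-∈ L (λ {x} _ → e x)

∑-mono-≤ : ∀ L {f g : A → ℕ} → (∀ x → f x ≤ g x) → ∑ L f ≤ ∑ L g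
∑-mono-≤ []      e = z≤n
∑-mono-≤ (x ∷ L) e = +-mono-≤ (e x) (∑-mono-≤ L e)

∑-zero-∈ : ∀ L {f : A → ℕ} → (∀ {x} → x ∈ L → f x ≡ 0) → ∑ L f ≡ 0
∑-zero-∈ []      e = refl
∑-zero-∈ (x ∷ L) e = cong₂ _+_ (e (here refl)) (∑-zero-∈ L (e ∘ there))

∑-+ : ∀ L (f g : A → ℕ) → ∑[ x ← L ] (f x + g x) ≡ ∑ L f + ∑ L g
∑-+ []      f g = refl
∑-+ (x ∷ L) f g rewrite ∑-+ L f g = interchange (f x) (g x) (∑ L f) (∑ L g)

∑-*ˡ : ∀ L (c : ℕ) (f : A → ℕ) → ∑[ x ← L ] (c * f x) ≡ c * ∑ L f
∑-*ˡ []      c f = sym (*-zeroʳ c)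
∑-*ˡ (x ∷ L) c f rewrite ∑-*ˡ L c f = sym (*-distribˡ-+ c (f x) (∑ L f))

∑-*ʳ : ∀ L (f : A → ℕ) (c : ℕ) → ∑[ x ← L ] (f x * c) ≡ ∑ L f * c
∑-*ʳ []      f c = refl
∑-*ʳ (x ∷ L) f c rewrite ∑-*ʳ L f c = sym (*-distribʳ-+ c (f x) (∑ L f))

∑-++ : ∀ L M (f : A → ℕ) → ∑ (L ++ M) f ≡ ∑ L f + ∑ M f
∑-++ []      M f = refl
∑-++ (x ∷ L) M f rewrite ∑-++ L M f = sym (+-assoc (f x) (∑ L f) (∑ M f))

∑-map : ∀ L (h : A → B) (f : B → ℕ) → ∑ (map h L) f ≡ ∑[ x ← L ] f (h x)
∑-map []      h f = refl
∑-map (x ∷ L) h f = cong (f (h x) +_) (∑-map L h f)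

∑-concatMap : ∀ L (h : A → List B) (f : B → ℕ) → ∑ (concatMap h L) f ≡ ∑[ x ← L ] ∑ (h x) f
∑-concatMap []      h f = refl
∑-concatMap (x ∷ L) h f = trans (∑-++ (h x) (concatMap h L) f) (cong (∑ (h x) f +_) (∑-concatMap L h f))

∑-swap : ∀ L (M : List B) (f : A → B → ℕ) →
         ∑[ x ← L ] ∑[ y ← M ] f x y ≡ ∑[ y ← M ] ∑[ x ← L ] f x y
∑-swap []      M f = sym (∑-zero-∈ M (λ _ → refl))
∑-swap (x ∷ L) M f rewrite ∑-swap L M f = sym (∑-+ M (f x) (λ y → ∑[ x′ ← L ] f x′ y))

∑-single : ∀ {L} {f : A → ℕ} {x₀} → Unique L → x₀ ∈ L → (∀ x → x ≢ x₀ → f x ≡ 0) →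
           ∑ L f ≡ f x₀
∑-single {L = x ∷ L} {f = f} (x∉L ∷ !L) (here refl) off =
  trans (cong (f x +_) (∑-zero-∈ L (λ y∈L → off _ (All.lookup x∉L y∈L ∘ sym)))) (+-identityʳ (f x))
∑-single {L = x ∷ L} {f = f} (x∉L ∷ !L) (there x₀∈L) off =
  trans (cong (_+ ∑ L f) (off x (All.lookup x∉L x₀∈L))) (∑-single !L x₀∈L off)

∑-≤1 : ∀ {L : List A} {f : A → ℕ} → Unique L → (∀ x → f x ≤ 1) →
       (∀ {x y} → 0 < f x → 0 < f y → x ≡ y) → ∑ L f ≤ 1
∑-≤1 {L = []}    _          _  _    = z≤n
∑-≤1 {L = x ∷ L} {f} (x∉L ∷ !L) ≤1 same with f x in fx
... | zero  = ∑-≤1 !L ≤1 same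
... | suc c = begin
  suc c + ∑ L f ≡⟨ cong (suc c +_) (∑-zero-∈ L vanish) ⟩
  suc c + 0     ≡⟨ +-identityʳ (suc c) ⟩
  suc c         ≡⟨ sym fx ⟩
  f x           ≤⟨ ≤1 x ⟩
  1             ∎
  where
  open ≤-Reasoning
  vanish : ∀ {y} → y ∈ L → f y ≡ 0
  vanish y∈L = n≤0⇒n≡0 (≮⇒≥ λ 0<fy → All.lookup x∉L y∈L (same (subst (0 <_) (sym fx) z<s) 0<fy))

module _ (n : ℕ) where

  ∑-allLists-∷ : ∀ m (f : List (Fin n) → ℕ) →
                 ∑ (allLists n (suc m)) f ≡ ∑[ x ← allFin n ] ∑[ ys ← allLists n m ] f (x ∷ ys)
  ∑-allLists-∷ m f =
    trans (∑-concatMap (allFin n) _ f) (∑-cong (allFin n) (λ x → ∑-map (allLists n m) (x ∷_) f))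

  ∑-allLists-∷ʳ : ∀ m (f : List (Fin n) → ℕ) →
                  ∑ (allLists n (suc m)) f ≡ ∑[ ys ← allLists n m ] ∑[ x ← allFin n ] f (ys ∷ʳ x)
  ∑-allLists-∷ʳ zero    f =
    trans (∑-allLists-∷ 0 f) (trans (∑-cong (allFin n) (λ x → +-identityʳ _)) (sym (+-identityʳ _)))
  ∑-allLists-∷ʳ (suc m) f = begin
    ∑ (allLists n (suc (suc m))) f
      ≡⟨ ∑-allLists-∷ (suc m) f ⟩
    ∑[ x ← allFin n ] ∑[ ys ← allLists n (suc m) ] f (x ∷ ys)
      ≡⟨ ∑-cong (allFin n) (λ x → ∑-allLists-∷ʳ m (λ ys → f (x ∷ ys))) ⟩
    ∑[ x ← allFin n ] ∑[ ys ← allLists n m ] ∑[ z ← allFin n ] f (x ∷ ys ∷ʳ z)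
      ≡⟨ ∑-allLists-∷ m (λ ys → ∑[ z ← allFin n ] f (ys ∷ʳ z)) ⟨
    ∑[ ys ← allLists n (suc m) ] ∑[ z ← allFin n ] f (ys ∷ʳ z) ∎
    where open ≡-Reasoning

  ∑-allLists-reverse : ∀ m (f : List (Fin n) → ℕ) →
                       ∑ (allLists n m) f ≡ ∑[ xs ← allLists n m ] f (reverse xs)
  ∑-allLists-reverse zero    f = refl
  ∑-allLists-reverse (suc m) f = begin
    ∑ (allLists n (suc m)) f
      ≡⟨ ∑-allLists-∷ m f ⟩
    ∑[ x ← allFin n ] ∑[ ys ← allLists n m ] f (x ∷ ys)
      ≡⟨ ∑-cong (allFin n) (λ x → ∑-allLists-reverse m (λ ys → f (x ∷ ys))) ⟩
    ∑[ x ← allFin n ] ∑[ ys ← allLists n m ] f (x ∷ reverse ys)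
      ≡⟨ ∑-swap (allFin n) (allLists n m) (λ x ys → f (x ∷ reverse ys)) ⟩
    ∑[ ys ← allLists n m ] ∑[ x ← allFin n ] f (x ∷ reverse ys)
      ≡⟨ ∑-cong (allLists n m) (λ ys → ∑-cong (allFin n) (λ x → cong f (reverse-++ ys (x ∷ [])))) ⟨
    ∑[ ys ← allLists n m ] ∑[ x ← allFin n ] f (reverse (ys ∷ʳ x))
      ≡⟨ ∑-allLists-∷ʳ m (f ∘ reverse) ⟨
    ∑[ xs ← allLists n (suc m) ] f (reverse xs) ∎
    where open ≡-Reasoning

  ∑-allLists-++ : ∀ a b (f : List (Fin n) → ℕ) →
                  ∑ (allLists n (a + b)) f ≡ ∑[ ys ← allLists n a ] ∑[ zs ← allLists n b ] f (ys ++ zs)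
  ∑-allLists-++ zero    b f = sym (+-identityʳ _)
  ∑-allLists-++ (suc a) b f =
    trans (∑-allLists-∷ (a + b) f)
          (trans (∑-cong (allFin n) (λ x → ∑-allLists-++ a b (λ ys → f (x ∷ ys))))
                 (sym (∑-allLists-∷ a _)))

  allLists-unique : ∀ m → Unique (allLists n m)
  allLists-unique zero    = [] ∷ []
  allLists-unique (suc m) = Uniqueₚ.concat⁺
    (Allₚ.map⁺ (All.universal (λ x → Uniqueₚ.map⁺ ∷-injectiveʳ (allLists-unique m)) (allFin n)))
    (AllPairsₚ.map⁺ (AllPairs.map heads-differ (Uniqueₚ.allFin⁺ n)))
    where
    heads-differ : ∀ {x y} → x ≢ y → Disjoint (map (x ∷_) (allLists n m)) (map (y ∷_) (allLists n m))
    heads-differ x≢y (p , q) with ∈-map⁻ _ p | ∈-map⁻ _ q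
    ... | _ , _ , refl | _ , _ , eq = x≢y (proj₁ (∷-injective eq))

  ∈-allLists : ∀ {m} (xs : List (Fin n)) → length xs ≡ m → xs ∈ allLists n m
  ∈-allLists []       refl = here refl
  ∈-allLists (x ∷ xs) refl =
    ∈-concat⁺′ (∈-map⁺ (x ∷_) (∈-allLists xs refl)) (∈-map⁺ _ (∈-allFin x))

  ∈-allLists⇒length : ∀ m {xs : List (Fin n)} → xs ∈ allLists n m → length xs ≡ m
  ∈-allLists⇒length zero    (here refl) = refl
  ∈-allLists⇒length (suc m) xs∈ with ∈-concat⁻′ (map (λ x → map (x ∷_) (allLists n m)) (allFin n)) xs∈
  ... | ys , xs∈ys , ys∈ with ∈-map⁻ (λ x → map (x ∷_) (allLists n m)) ys∈
  ... | x , _ , refl with ∈-map⁻ (x ∷_) xs∈ys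
  ... | zs , zs∈ , refl = cong suc (∈-allLists⇒length m zs∈)

𝟙 : {P : Set} → Dec P → ℕ
𝟙 (yes _) = 1
𝟙 (no  _) = 0

module _ {P Q : Set} where

  𝟙-cong : (P → Q) → (Q → P) → (p : Dec P) (q : Dec Q) → 𝟙 p ≡ 𝟙 q
  𝟙-cong f g (yes a) (yes b) = refl
  𝟙-cong f g (yes a) (no ¬b) = ⊥-elim (¬b (f a))
  𝟙-cong f g (no ¬a) (yes b) = ⊥-elim (¬a (g b))
  𝟙-cong f g (no ¬a) (no ¬b) = refl

  𝟙-× : (p : Dec P) (q : Dec Q) → 𝟙 (p ×-dec q) ≡ 𝟙 p * 𝟙 q
  𝟙-× (yes _) (yes _) = refl
  𝟙-× (yes _) (no  _) = refl
  𝟙-× (no  _) _       = refl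

  𝟙-split : (p : Dec P) (q : Dec Q) → 𝟙 p ≡ 𝟙 (p ×-dec q) + 𝟙 (p ×-dec ¬? q)
  𝟙-split (yes _) (yes _) = refl
  𝟙-split (yes _) (no  _) = refl
  𝟙-split (no  _) _       = refl

module _ {P : Set} where

  𝟙-false : ¬ P → (p : Dec P) → 𝟙 p ≡ 0
  𝟙-false ¬a (yes a) = ⊥-elim (¬a a)
  𝟙-false _  (no _)  = refl

  𝟙-true : P → (p : Dec P) → 𝟙 p ≡ 1
  𝟙-true _ (yes _) = refl
  𝟙-true a (no ¬a) = ⊥-elim (¬a a)

  𝟙-positive : (p : Dec P) → 0 < 𝟙 p → P
  𝟙-positive (yes a) _ = a

  𝟙≤1 : (p : Dec P) → 𝟙 p ≤ 1
  𝟙≤1 (yes _) = s≤s z≤n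
  𝟙≤1 (no _)  = z≤n

  *-𝟙-cong : (p : Dec P) {a b : ℕ} → (P → a ≡ b) → a * 𝟙 p ≡ b * 𝟙 p
  *-𝟙-cong (yes x) f         = cong (_* 1) (f x)
  *-𝟙-cong (no _)  {a} {b} _ = trans (*-zeroʳ a) (sym (*-zeroʳ b))

count≡∑𝟙 : (p : A → Bool) (xs : List A) → count p xs ≡ ∑[ x ← xs ] 𝟙 (p x Bool.≟ true)
count≡∑𝟙 p []       = refl
count≡∑𝟙 p (x ∷ xs) with p x
... | true  = cong suc (count≡∑𝟙 p xs)
... | false = count≡∑𝟙 p xs

∑-𝟙-except : ∀ {P Q : A → Set} {L x₀} → Unique L → x₀ ∈ L → (P? : ∀ x → Dec (P x)) (Q? : ∀ x → Dec (Q x)) →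
             P x₀ → Q x₀ → (∀ {x} → P x → Q x → x ≡ x₀) →
             ∑[ x ← L ] 𝟙 (P? x ×-dec ¬? (Q? x)) ≡ (∑[ x ← L ] 𝟙 (P? x)) ∸ 1
∑-𝟙-except {L = L} {x₀} !L x₀∈L P? Q? p₀ q₀ only = sym (begin
  (∑[ x ← L ] 𝟙 (P? x)) ∸ 1
    ≡⟨ cong (_∸ 1) (∑-cong L (λ x → 𝟙-split (P? x) (Q? x))) ⟩
  (∑[ x ← L ] (𝟙 (P? x ×-dec Q? x) + 𝟙 (P? x ×-dec ¬? (Q? x)))) ∸ 1
    ≡⟨ cong (_∸ 1) (∑-+ L _ _) ⟩
  (∑[ x ← L ] 𝟙 (P? x ×-dec Q? x)) + (∑[ x ← L ] 𝟙 (P? x ×-dec ¬? (Q? x))) ∸ 1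
    ≡⟨ cong (λ c → c + (∑[ x ← L ] 𝟙 (P? x ×-dec ¬? (Q? x))) ∸ 1) just-x₀ ⟩
  1 + (∑[ x ← L ] 𝟙 (P? x ×-dec ¬? (Q? x))) ∸ 1
    ≡⟨ m+n∸m≡n 1 _ ⟩
  ∑[ x ← L ] 𝟙 (P? x ×-dec ¬? (Q? x)) ∎)
  where
  open ≡-Reasoning
  just-x₀ : ∑[ x ← L ] 𝟙 (P? x ×-dec Q? x) ≡ 1
  just-x₀ = trans
    (∑-single !L x₀∈L (λ x x≢x₀ → 𝟙-false (λ (p , q) → x≢x₀ (only p q)) (P? x ×-dec Q? x)))
    (𝟙-true (p₀ , q₀) (P? x₀ ×-dec Q? x₀))

-- The defect of a function bounded by k

*-∸-lower-bound : ∀ {k a} → 0 < a → a < k → k ∸ 1 ≤ a * (k ∸ a)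
*-∸-lower-bound {suc k} {suc b} _ (s≤s b<k) with k ∸ b | m+[n∸m]≡n (<⇒≤ b<k)
... | zero  | b+0≡k = ⊥-elim (<-irrefl (trans (sym (+-identityʳ b)) b+0≡k) b<k)
... | suc c | b+1+c≡k = begin
  k               ≡⟨ b+1+c≡k ⟨
  b + suc c       ≡⟨ +-comm b (suc c) ⟩
  suc c + b       ≤⟨ +-monoʳ-≤ (suc c) (m≤m*n b (suc c)) ⟩
  suc c + b * suc c ∎
  where open ≤-Reasoning

defect-dichotomy : ∀ {k a} → a ≤ k →
                   (k ∣ a × a * (k ∸ a) ≡ 0) ⊎ (¬ k ∣ a × k ∸ 1 ≤ a * (k ∸ a))
defect-dichotomy {k} {zero}  _   = inj₁ (k ∣0 , refl)
defect-dichotomy {k} {suc b} a≤k with m≤n⇒m<n∨m≡n a≤k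
... | inj₂ refl = inj₁ (∣-refl , trans (cong (suc b *_) (n∸n≡0 (suc b))) (*-zeroʳ (suc b)))
... | inj₁ a<k  = inj₂ ((λ k∣a → <⇒≱ a<k (∣⇒≤ k∣a)) , *-∸-lower-bound z<s a<k)

module Defect {A : Set} (k : ℕ) (f : A → ℕ) (f≤k : ∀ x → f x ≤ k) where

  defect : List A → ℕ
  defect L = ∑[ x ← L ] f x * (k ∸ f x)

  small-defect⇒∣ : ∀ L → defect L < k ∸ 1 → k ∣ ∑ L f
  small-defect⇒∣ []      _     = k ∣0
  small-defect⇒∣ (x ∷ L) small with defect-dichotomy (f≤k x)
  ... | inj₁ (k∣fx , term≡0) =
    ∣m∣n⇒∣m+n k∣fx (small-defect⇒∣ L (subst (λ c → c + defect L < k ∸ 1) term≡0 small))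
  ... | inj₂ (_ , k-1≤term) = ⊥-elim (<⇒≱ small (≤-trans k-1≤term (m≤m+n _ (defect L))))

  defect-gap : ∀ L → k ∣ ∑ L f → defect L < (k ∸ 1) + (k ∸ 1) → defect L ≡ 0
  defect-gap []      _   _     = refl
  defect-gap (x ∷ L) k∣∑ small with defect-dichotomy (f≤k x)
  ... | inj₁ (k∣fx , term≡0) = trans (cong (_+ defect L) term≡0)
    (defect-gap L (∣m+n∣m⇒∣n k∣∑ k∣fx) (subst (λ c → c + defect L < (k ∸ 1) + (k ∸ 1)) term≡0 small))
  ... | inj₂ (k∤fx , k-1≤term) =
    ⊥-elim (k∤fx (∣m+n∣m⇒∣n (subst (k ∣_) (+-comm (f x) (∑ L f)) k∣∑) (small-defect⇒∣ L rest-small)))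
    where
    rest-small : defect L < k ∸ 1
    rest-small = +-cancelˡ-< (k ∸ 1) (defect L) (k ∸ 1) (≤-<-trans (+-monoˡ-≤ (defect L) k-1≤term) small)

*-∸-split : ∀ {a k} → a ≤ k → a * (a ∸ 1) + a * (k ∸ a) ≡ a * (k ∸ 1)
*-∸-split {zero}          _         = refl
*-∸-split {suc b} {suc k} (s≤s b≤k) =
  trans (sym (*-distribˡ-+ (suc b) b (k ∸ b))) (cong (suc b *_) (m+[n∸m]≡n b≤k))

-- If ε > M / 2 the truncated subtraction makes C = 0, and then D = M.
remainder-after-halving : ∀ M ε C D → 0 < M → 0 < ε → C ≡ M / 2 ∸ ε → C + C + D ≡ M →
                          0 < D × D ≤ suc (ε + ε)
remainder-after-halving M ε C D M>0 ε>0 C≡ C+C+D≡M with ε ≤? M / 2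
... | yes ε≤M/2 = subst (0 <_) (sym D≡) (≤-trans ε>0 (≤-trans (m≤m+n ε ε) (m≤n+m (ε + ε) (M % 2)))) ,
                  subst (_≤ suc (ε + ε)) (sym D≡) (+-monoˡ-≤ (ε + ε) (≤-pred (m%n<n M 2)))
  where
  D≡ : D ≡ M % 2 + (ε + ε)
  D≡ = +-cancelˡ-≡ (C + C) D (M % 2 + (ε + ε)) (begin
    C + C + D                         ≡⟨ C+C+D≡M ⟩
    M                                 ≡⟨ m≡m%n+[m/n]*n M 2 ⟩
    M % 2 + M / 2 * 2                 ≡⟨ cong (λ h → M % 2 + h * 2) (m∸n+n≡m ε≤M/2) ⟨
    M % 2 + (M / 2 ∸ ε + ε) * 2       ≡⟨ cong (λ c → M % 2 + (c + ε) * 2) C≡ ⟨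
    M % 2 + (C + ε) * 2               ≡⟨ rearrange (M % 2) C ε ⟩
    C + C + (M % 2 + (ε + ε))         ∎)
    where
    open ≡-Reasoning
    rearrange : ∀ r c e → r + (c + e) * 2 ≡ c + c + (r + (e + e))
    rearrange = solve-∀
... | no  ε≰M/2 = subst (0 <_) (sym D≡M) M>0 , subst (_≤ suc (ε + ε)) (sym D≡M) M≤
  where
  M/2<ε : M / 2 < ε
  M/2<ε = ≰⇒> ε≰M/2
  D≡M : D ≡ M
  D≡M = trans (sym (cong (λ c → c + c + D) (trans C≡ (m≤n⇒m∸n≡0 (<⇒≤ M/2<ε))))) C+C+D≡M
  M≤ : M ≤ suc (ε + ε)
  M≤ = begin
    M                   ≡⟨ m≡m%n+[m/n]*n M 2 ⟩
    M % 2 + M / 2 * 2   ≤⟨ +-mono-≤ (≤-pred (m%n<n M 2)) (*-monoˡ-≤ 2 (<⇒≤ M/2<ε)) ⟩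
    1 + ε * 2           ≡⟨ cong suc (*-comm ε 2) ⟩
    suc (2 * ε)         ≡⟨ cong (λ e → suc (ε + e)) (+-identityʳ ε) ⟩
    suc (ε + ε)         ∎
    where open ≤-Reasoning

suc-double<double : ∀ {ε K} → ε < K → suc (ε + ε) < K + K
suc-double<double {ε} {K} ε<K = subst (_≤ K + K) (cong suc (+-suc ε ε)) (+-mono-≤ ε<K ε<K)

-- Walks

∧-true⁻ : ∀ {b c : Bool} → b ∧ c ≡ true → b ≡ true × c ≡ true
∧-true⁻ {true} {true} _ = refl , refl

∧-true⁺ : ∀ {b c : Bool} → b ≡ true → c ≡ true → b ∧ c ≡ true
∧-true⁺ refl refl = refl

reverse-∷-∷ : ∀ (a b : A) l → reverse (a ∷ b ∷ l) ≡ reverse l ++ b ∷ a ∷ []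
reverse-∷-∷ a b l = begin
  reverse (a ∷ b ∷ l)          ≡⟨ unfold-reverse a (b ∷ l) ⟩
  reverse (b ∷ l) ∷ʳ a         ≡⟨ cong (_∷ʳ a) (unfold-reverse b l) ⟩
  (reverse l ∷ʳ b) ∷ʳ a        ≡⟨ ++-assoc (reverse l) (b ∷ []) (a ∷ []) ⟩
  reverse l ++ b ∷ a ∷ []      ∎
  where open ≡-Reasoning

Unique-++⁻ˡ : ∀ xs {ys : List A} → Unique (xs ++ ys) → Unique xs
Unique-++⁻ˡ []       _          = []
Unique-++⁻ˡ (x ∷ xs) (x∉ ∷ !xs) = Allₚ.++⁻ˡ xs x∉ ∷ Unique-++⁻ˡ xs !xs

Unique-++⁻ʳ : ∀ xs {ys : List A} → Unique (xs ++ ys) → Unique ys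
Unique-++⁻ʳ []       !ys        = !ys
Unique-++⁻ʳ (x ∷ xs) (_ ∷ !xs) = Unique-++⁻ʳ xs !xs

Unique-∷ʳ : ∀ {xs : List A} {x} → Unique xs → All (x ≢_) xs → Unique (xs ∷ʳ x)
Unique-∷ʳ []           []          = [] ∷ []
Unique-∷ʳ (y∉ ∷ !xs) (x≢y ∷ x∉) = Allₚ.++⁺ y∉ ((x≢y ∘ sym) ∷ []) ∷ Unique-∷ʳ !xs x∉

Unique-middle : ∀ xs {x : A} ys → Unique (xs ++ x ∷ ys) → All (x ≢_) xs
Unique-middle []       ys _          = []
Unique-middle (y ∷ xs) ys (y∉ ∷ !xs) = (All.head (Allₚ.++⁻ʳ xs y∉) ∘ sym) ∷ Unique-middle xs ys !xs

module _ {n : ℕ} where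

  lastOr-∷ʳ : ∀ (d : Fin n) xs x → lastOr d (xs ∷ʳ x) ≡ x
  lastOr-∷ʳ d []       x = refl
  lastOr-∷ʳ d (y ∷ xs) x = lastOr-∷ʳ y xs x

  lastOr-++-∷ : ∀ (d : Fin n) xs y ys → lastOr d (xs ++ y ∷ ys) ≡ lastOr y ys
  lastOr-++-∷ d []       y ys = refl
  lastOr-++-∷ d (x ∷ xs) y ys = lastOr-++-∷ x xs y ys

  lastOr-reverse : ∀ (d x : Fin n) xs → lastOr d (reverse (x ∷ xs)) ≡ x
  lastOr-reverse d x xs = trans (cong (lastOr d) (unfold-reverse x xs)) (lastOr-∷ʳ d (reverse xs) x)

  penultimateOr : Fin n → List (Fin n) → Fin n
  penultimateOr d []          = d
  penultimateOr d (a ∷ [])    = d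
  penultimateOr d (a ∷ b ∷ r) = penultimateOr a (b ∷ r)

  penultimateOr-∷ʳ : ∀ (d : Fin n) xs x → penultimateOr d (xs ∷ʳ x) ≡ lastOr d xs
  penultimateOr-∷ʳ d []           x = refl
  penultimateOr-∷ʳ d (a ∷ [])     x = refl
  penultimateOr-∷ʳ d (a ∷ b ∷ xs) x = penultimateOr-∷ʳ a (b ∷ xs) x

  init-last : ∀ (x : Fin n) xs → Σ (List (Fin n)) λ ys → x ∷ xs ≡ ys ∷ʳ lastOr x xs
  init-last x []       = [] , refl
  init-last x (y ∷ xs) = let ys , eq = init-last y xs in x ∷ ys , cong (x ∷_) eq

  lastOr-∉ : ∀ {y : Fin n} x xs → All (y ≢_) (x ∷ xs) → lastOr x xs ≢ y
  lastOr-∉ x []       (y≢x ∷ _) = y≢x ∘ sym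
  lastOr-∉ x (z ∷ xs) (_ ∷ y∉) = lastOr-∉ z xs y∉

module Walks {n : ℕ} (G : Graph n) where

  V : Set
  V = Fin n

  vertices : List V
  vertices = allFin n

  sequences : ℕ → List (List V)
  sequences = allLists n

  Adj : V → V → Set
  Adj a b = adj G a b ≡ true

  Adj-sym : ∀ {a b} → Adj a b → Adj b a
  Adj-sym {a} {b} e = trans (adj-sym G b a) e

  Walk : List V → Set
  Walk []          = ⊤
  Walk (a ∷ [])    = ⊤
  Walk (a ∷ b ∷ r) = Adj a b × Walk (b ∷ r)

  NonBacktracking : List V → Set
  NonBacktracking []              = ⊤
  NonBacktracking (a ∷ [])        = ⊤
  NonBacktracking (a ∷ b ∷ [])    = ⊤
  NonBacktracking (a ∷ b ∷ c ∷ r) = a ≢ c × NonBacktracking (b ∷ c ∷ r)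

  NoUTurn : List V → List V → Set
  NoUTurn []      _       = ⊤
  NoUTurn (a ∷ r) []      = ⊤
  NoUTurn (a ∷ r) (b ∷ _) = lastOr a r ≢ b

  Adj? : ∀ a b → Dec (Adj a b)
  Adj? a b = adj G a b Bool.≟ true

  Walk? : ∀ l → Dec (Walk l)
  Walk? []          = yes tt
  Walk? (a ∷ [])    = yes tt
  Walk? (a ∷ b ∷ r) = Adj? a b ×-dec Walk? (b ∷ r)

  NonBacktracking? : ∀ l → Dec (NonBacktracking l)
  NonBacktracking? []              = yes tt
  NonBacktracking? (a ∷ [])        = yes tt
  NonBacktracking? (a ∷ b ∷ [])    = yes tt
  NonBacktracking? (a ∷ b ∷ c ∷ r) = ¬? (a ≟ c) ×-dec NonBacktracking? (b ∷ c ∷ r)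

  NoUTurn? : ∀ xs ys → Dec (NoUTurn xs ys)
  NoUTurn? []      _       = yes tt
  NoUTurn? (a ∷ r) []      = yes tt
  NoUTurn? (a ∷ r) (b ∷ _) = ¬? (lastOr a r ≟ b)

  Walk-tail : ∀ {a} l → Walk (a ∷ l) → Walk l
  Walk-tail []      _       = tt
  Walk-tail (b ∷ l) (_ , w) = w

  Walk-++⁻ˡ : ∀ xs {ys} → Walk (xs ++ ys) → Walk xs
  Walk-++⁻ˡ []           _       = tt
  Walk-++⁻ˡ (a ∷ [])     _       = tt
  Walk-++⁻ˡ (a ∷ b ∷ xs) (e , w) = e , Walk-++⁻ˡ (b ∷ xs) w

  Walk-++⁻ʳ : ∀ xs {ys} → Walk (xs ++ ys) → Walk ys
  Walk-++⁻ʳ []       w = w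
  Walk-++⁻ʳ (a ∷ xs) w = Walk-++⁻ʳ xs (Walk-tail (xs ++ _) w)

  Walk-join : ∀ xs y ys → Walk (xs ∷ʳ y) → Walk (y ∷ ys) → Walk (xs ++ y ∷ ys)
  Walk-join []           y ys _        w₂ = w₂
  Walk-join (a ∷ [])     y ys (e , _)  w₂ = e , w₂
  Walk-join (a ∷ b ∷ xs) y ys (e , w₁) w₂ = e , Walk-join (b ∷ xs) y ys w₁ w₂

  NonBacktracking-tail : ∀ {a} l → NonBacktracking (a ∷ l) → NonBacktracking l
  NonBacktracking-tail []          _       = tt
  NonBacktracking-tail (b ∷ [])    _       = tt
  NonBacktracking-tail (b ∷ c ∷ l) (_ , w) = w

  NonBacktracking-++⁻ˡ : ∀ xs {ys} → NonBacktracking (xs ++ ys) → NonBacktracking xs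
  NonBacktracking-++⁻ˡ []               _       = tt
  NonBacktracking-++⁻ˡ (a ∷ [])         _       = tt
  NonBacktracking-++⁻ˡ (a ∷ b ∷ [])     _       = tt
  NonBacktracking-++⁻ˡ (a ∷ b ∷ c ∷ xs) (e , w) = e , NonBacktracking-++⁻ˡ (b ∷ c ∷ xs) w

  NoUTurn-tail : ∀ a b r ys → NoUTurn (a ∷ b ∷ r) ys → NoUTurn (b ∷ r) ys
  NoUTurn-tail a b r []      _ = tt
  NoUTurn-tail a b r (_ ∷ _) j = j

  NoUTurn-∷ʳ : ∀ xs {c a} t → c ≢ a → NoUTurn (xs ∷ʳ c) (a ∷ t)
  NoUTurn-∷ʳ []       t c≢a = c≢a
  NoUTurn-∷ʳ (x ∷ xs) t c≢a = subst (_≢ _) (sym (lastOr-∷ʳ x xs _)) c≢a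

  NonBacktracking-join : ∀ xs y ys → NonBacktracking (xs ∷ʳ y) → NonBacktracking (y ∷ ys) →
                         NoUTurn xs ys → NonBacktracking (xs ++ y ∷ ys)
  NonBacktracking-join []               y ys       _        nb₂ _ = nb₂
  NonBacktracking-join (a ∷ [])         y []       _        _   _ = tt
  NonBacktracking-join (a ∷ [])         y (b ∷ ys) _        nb₂ j = j , nb₂
  NonBacktracking-join (a ∷ b ∷ [])     y ys       (e , _)  nb₂ j =
    e , NonBacktracking-join (b ∷ []) y ys tt nb₂ (NoUTurn-tail a b [] ys j)
  NonBacktracking-join (a ∷ b ∷ c ∷ xs) y ys       (e , nb₁) nb₂ j =
    e , NonBacktracking-join (b ∷ c ∷ xs) y ys nb₁ nb₂ (NoUTurn-tail a b (c ∷ xs) ys j)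

  Walk-reverse : ∀ l → Walk l → Walk (reverse l)
  Walk-reverse []          _       = tt
  Walk-reverse (a ∷ [])    _       = tt
  Walk-reverse (a ∷ b ∷ l) (e , w) = subst Walk (sym (reverse-∷-∷ a b l))
    (Walk-join (reverse l) b (a ∷ []) (subst Walk (unfold-reverse b l) (Walk-reverse (b ∷ l) w)) (Adj-sym e , tt))

  NonBacktracking-reverse : ∀ l → NonBacktracking l → NonBacktracking (reverse l)
  NonBacktracking-reverse []          _ = tt
  NonBacktracking-reverse (a ∷ [])    _ = tt
  NonBacktracking-reverse (a ∷ b ∷ []) _ = tt
  NonBacktracking-reverse (a ∷ b ∷ c ∷ l) (a≢c , nb) = subst NonBacktracking (sym split)
    (NonBacktracking-join (reverse l ∷ʳ c) b (a ∷ [])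
      (subst NonBacktracking (trans (reverse-∷-∷ b c l) (sym (++-assoc (reverse l) (c ∷ []) (b ∷ []))))
        (NonBacktracking-reverse (b ∷ c ∷ l) nb))
      tt
      (NoUTurn-∷ʳ (reverse l) [] (a≢c ∘ sym)))
    where
    open ≡-Reasoning
    split : reverse (a ∷ b ∷ c ∷ l) ≡ (reverse l ∷ʳ c) ++ b ∷ a ∷ []
    split = begin
      reverse (a ∷ b ∷ c ∷ l)          ≡⟨ unfold-reverse a (b ∷ c ∷ l) ⟩
      reverse (b ∷ c ∷ l) ∷ʳ a         ≡⟨ cong (_∷ʳ a) (reverse-∷-∷ b c l) ⟩
      (reverse l ++ c ∷ b ∷ []) ++ a ∷ [] ≡⟨ ++-assoc (reverse l) (c ∷ b ∷ []) (a ∷ []) ⟩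
      reverse l ++ c ∷ b ∷ a ∷ []     ≡⟨ ++-assoc (reverse l) (c ∷ []) (b ∷ a ∷ []) ⟨
      (reverse l ∷ʳ c) ++ b ∷ a ∷ []   ∎

  Unique⇒NonBacktracking : ∀ l → Unique l → NonBacktracking l
  Unique⇒NonBacktracking []          _ = tt
  Unique⇒NonBacktracking (a ∷ [])    _ = tt
  Unique⇒NonBacktracking (a ∷ b ∷ []) _ = tt
  Unique⇒NonBacktracking (a ∷ b ∷ c ∷ l) ((_ ∷ a≢c ∷ _) ∷ !l) =
    a≢c , Unique⇒NonBacktracking (b ∷ c ∷ l) !l

  ∉-or-split : ∀ (x : V) ys → All (x ≢_) ys ⊎ ∃₂ λ pre post → ys ≡ pre ++ x ∷ post
  ∉-or-split x ys with any? (λ y → x ≟ y) ys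
  ... | no  x∉ = inj₁ (Allₚ.¬Any⇒All¬ ys x∉)
  ... | yes x∈ = let pre , post , eq = ∈-∃++ x∈ in inj₂ (pre , post , eq)

  any-≟-false⇒∉ : ∀ (x : V) ys → any (λ y → ⌊ x ≟ y ⌋) ys ≡ false → All (x ≢_) ys
  any-≟-false⇒∉ x []       _ = []
  any-≟-false⇒∉ x (y ∷ ys) e with x ≟ y
  ... | no x≢y = x≢y ∷ any-≟-false⇒∉ x ys e
  any-≟-false⇒∉ x (y ∷ ys) () | yes _

  ∉⇒any-≟-false : ∀ (x : V) ys → All (x ≢_) ys → any (λ y → ⌊ x ≟ y ⌋) ys ≡ false
  ∉⇒any-≟-false x []       []          = refl
  ∉⇒any-≟-false x (y ∷ ys) (x≢y ∷ x∉) with x ≟ y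
  ... | yes x≡y = ⊥-elim (x≢y x≡y)
  ... | no  _   = ∉⇒any-≟-false x ys x∉

  distinct⇒Unique : ∀ l → distinct l ≡ true → Unique l
  distinct⇒Unique []      _ = []
  distinct⇒Unique (x ∷ l) d with any (λ y → ⌊ x ≟ y ⌋) l in e
  ... | false = any-≟-false⇒∉ x l e ∷ distinct⇒Unique l d
  distinct⇒Unique (x ∷ l) () | true

  Unique⇒distinct : ∀ l → Unique l → distinct l ≡ true
  Unique⇒distinct []      _          = refl
  Unique⇒distinct (x ∷ l) (x∉ ∷ !l) rewrite ∉⇒any-≟-false x l x∉ = Unique⇒distinct l !l

  pathClose⇒Walk : ∀ x₀ a l → pathClose G x₀ (a ∷ l) ≡ true → Walk ((a ∷ l) ∷ʳ x₀)
  pathClose⇒Walk x₀ a []      e = e , tt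
  pathClose⇒Walk x₀ a (b ∷ l) e =
    let e₁ , e₂ = ∧-true⁻ {adj G a b} e in e₁ , pathClose⇒Walk x₀ b l e₂

  Walk⇒pathClose : ∀ x₀ a l → Walk ((a ∷ l) ∷ʳ x₀) → pathClose G x₀ (a ∷ l) ≡ true
  Walk⇒pathClose x₀ a []      (e , _) = e
  Walk⇒pathClose x₀ a (b ∷ l) (e , w) = ∧-true⁺ e (Walk⇒pathClose x₀ b l w)

  isCycleSeq⇒closedPath : ∀ a l → isCycleSeq G (a ∷ l) ≡ true → Unique (a ∷ l) × Walk ((a ∷ l) ∷ʳ a)
  isCycleSeq⇒closedPath a (b ∷ c ∷ r) e =
    let e₁ , e₂ = ∧-true⁻ {distinct (a ∷ b ∷ c ∷ r)} e
    in distinct⇒Unique _ e₁ , pathClose⇒Walk a a (b ∷ c ∷ r) e₂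

  closedPath⇒isCycleSeq : ∀ a b p q r → Unique (a ∷ b ∷ p ++ q ∷ r) → Walk ((a ∷ b ∷ p ++ q ∷ r) ∷ʳ a) →
                          isCycleSeq G (a ∷ b ∷ p ++ q ∷ r) ≡ true
  closedPath⇒isCycleSeq a b []      q r !l w =
    ∧-true⁺ (Unique⇒distinct _ !l) (Walk⇒pathClose a a (b ∷ q ∷ r) w)
  closedPath⇒isCycleSeq a b (c ∷ p) q r !l w =
    ∧-true⁺ (Unique⇒distinct _ !l) (Walk⇒pathClose a a (b ∷ c ∷ p ++ q ∷ r) w)

  Walk-reverse-join : ∀ a xs ys → Walk (a ∷ xs) → Walk (a ∷ ys) → Walk (reverse xs ++ a ∷ ys)
  Walk-reverse-join a xs ys w₁ w₂ =
    Walk-join (reverse xs) a ys (subst Walk (unfold-reverse a xs) (Walk-reverse (a ∷ xs) w₁)) w₂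

  NonBacktracking-reverse-join : ∀ a b r c t → NonBacktracking (a ∷ b ∷ r) → NonBacktracking (a ∷ c ∷ t) →
                                 b ≢ c → NonBacktracking (reverse (b ∷ r) ++ a ∷ c ∷ t)
  NonBacktracking-reverse-join a b r c t nb₁ nb₂ b≢c =
    NonBacktracking-join (reverse (b ∷ r)) a (c ∷ t)
      (subst NonBacktracking (unfold-reverse a (b ∷ r)) (NonBacktracking-reverse (a ∷ b ∷ r) nb₁)) nb₂
      (subst (λ l → NoUTurn l (c ∷ t)) (sym (unfold-reverse b r)) (NoUTurn-∷ʳ (reverse r) t b≢c))

  module NoShortCycles (g : ℕ) (no-short-cycle : ∀ m → m < g → ¬ HasCycle G m) where

    short-nonBacktracking⇒Unique : ∀ l → Walk l → NonBacktracking l → length l ≤ g → Unique l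
    short-nonBacktracking⇒Unique []       _ _  _ = []
    short-nonBacktracking⇒Unique (x ∷ ys) w nb len
      with short-nonBacktracking⇒Unique ys (Walk-tail ys w) (NonBacktracking-tail ys nb) (≤-trans (n≤1+n _) len)
         | ∉-or-split x ys
    ... | !ys | inj₁ x∉ys              = x∉ys ∷ !ys
    ... | !ys | inj₂ (pre , post , refl) =
      ⊥-elim (no-return pre w nb len (Unique-++⁻ˡ pre !ys) (Unique-middle pre post !ys))
      where
      no-return : ∀ pre → Walk (x ∷ pre ++ x ∷ post) → NonBacktracking (x ∷ pre ++ x ∷ post) →
                  length (x ∷ pre ++ x ∷ post) ≤ g → Unique pre → All (x ≢_) pre → ⊥
      no-return []          (x~x , _) _          _   _    _    with () ← trans (sym x~x) (irrfl G x)
      no-return (p ∷ [])    _         (x≢x , _)  _   _    _    = x≢x refl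
      no-return (p ∷ q ∷ r) w         _          len !pre x∉pre =
        no-short-cycle (length cycle) shorter
          (cycle , refl , closedPath⇒isCycleSeq x p [] q r (x∉pre ∷ !pre) closed)
        where
        cycle = x ∷ p ∷ q ∷ r
        closed : Walk (cycle ∷ʳ x)
        closed = Walk-++⁻ˡ (cycle ∷ʳ x) (subst Walk (sym (++-assoc cycle (x ∷ []) post)) w)
        shorter : length cycle < g
        shorter = ≤-trans (s≤s (s≤s (s≤s (subst (length r <_) (sym (length-++ r)) (m<m+n (length r) z<s)))))
                          len

    short-walks-coincide : ∀ a xs ys → Walk (a ∷ xs) → NonBacktracking (a ∷ xs) →
                           Walk (a ∷ ys) → NonBacktracking (a ∷ ys) →
                           lastOr a xs ≡ lastOr a ys → length xs + length ys < g → xs ≡ ys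
    short-walks-coincide a [] [] _ _ _ _ _ _ = refl
    short-walks-coincide a [] (b ∷ r) _ _ w nb e len =
      ⊥-elim (lastOr-∉ b r (AllPairs.head (short-nonBacktracking⇒Unique (a ∷ b ∷ r) w nb len)) (sym e))
    short-walks-coincide a (b ∷ r) [] w nb _ _ e len =
      ⊥-elim (lastOr-∉ b r (AllPairs.head (short-nonBacktracking⇒Unique (a ∷ b ∷ r) w nb len′)) e)
      where
      len′ : length (a ∷ b ∷ r) ≤ g
      len′ = ≤-trans (≤-reflexive (sym (+-identityʳ _))) len
    short-walks-coincide a (b ∷ r) (c ∷ t) w₁ nb₁ w₂ nb₂ e len with b ≟ c
    ... | yes refl = cong (b ∷_)
      (short-walks-coincide b r t (proj₂ w₁) (NonBacktracking-tail _ nb₁) (proj₂ w₂) (NonBacktracking-tail _ nb₂) e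
        (≤-trans (s≤s (+-monoʳ-≤ (length r) (n≤1+n (length t)))) (≤-trans (n≤1+n _) len)))
    -- Otherwise going back along the first walk and out along the second is a non-backtracking
    -- walk of length at most g from the endpoint ℓ back to ℓ, so it repeats a vertex.
    ... | no b≢c = ⊥-elim (lastOr-∉ c t ℓ∉ (sym e))
      where
      ℓ = lastOr b r
      Y = proj₁ (init-last b r)
      reverse≡ : reverse (b ∷ r) ≡ ℓ ∷ reverse Y
      reverse≡ = trans (cong reverse (proj₂ (init-last b r))) (reverse-++ Y (ℓ ∷ []))
      length≤ : length (reverse (b ∷ r) ++ a ∷ c ∷ t) ≤ g
      length≤ = subst (_≤ g) (sym (trans (length-++ (reverse (b ∷ r)))
                  (trans (cong (_+ _) (length-reverse (b ∷ r))) (+-suc (suc (length r)) (suc (length t)))))) len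
      closed : Unique (ℓ ∷ reverse Y ++ a ∷ c ∷ t)
      closed = subst (λ l → Unique (l ++ a ∷ c ∷ t)) reverse≡
        (short-nonBacktracking⇒Unique _ (Walk-reverse-join a (b ∷ r) (c ∷ t) w₁ w₂)
                                        (NonBacktracking-reverse-join a b r c t nb₁ nb₂ b≢c) length≤)
      ℓ∉ : All (ℓ ≢_) (c ∷ t)
      ℓ∉ = All.tail (Allₚ.++⁻ʳ (reverse Y) (AllPairs.head closed))

-- Non-backtracking walks into a vertex and cycles through it

module Arrivals {n : ℕ} (G : Graph n) (k : ℕ) (regular : Regular G k) (v : Fin n) where
  open Walks G

  Arrives : ℕ → V → List V → Set
  Arrives m w A = Walk (w ∷ A) × NonBacktracking (w ∷ A) × lastOr w A ≡ v × length A ≡ m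

  Arrives? : ∀ m w A → Dec (Arrives m w A)
  Arrives? m w A = Walk? (w ∷ A) ×-dec NonBacktracking? (w ∷ A) ×-dec lastOr w A ≟ v ×-dec length A ℕ.≟ m

  FirstStep : V → V → List V → Set
  FirstStep x y R = Adj x y × NoUTurn (x ∷ []) R

  FirstStep? : ∀ x y R → Dec (FirstStep x y R)
  FirstStep? x y R = Adj? x y ×-dec NoUTurn? (x ∷ []) R

  Arrives-∷ : ∀ m x y R → 𝟙 (Arrives? (suc m) x (y ∷ R)) ≡ 𝟙 (FirstStep? x y R) * 𝟙 (Arrives? m y R)
  Arrives-∷ m x y R =
    trans (𝟙-cong (split R) (join R) (Arrives? (suc m) x (y ∷ R)) (FirstStep? x y R ×-dec Arrives? m y R))
          (𝟙-× (FirstStep? x y R) (Arrives? m y R))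
    where
    split : ∀ R → Arrives (suc m) x (y ∷ R) → FirstStep x y R × Arrives m y R
    split []      ((e , w) , nb       , l , len) = (e , tt) , w , tt , l , suc-injective len
    split (z ∷ R) ((e , w) , (ne , nb) , l , len) = (e , ne) , w , nb , l , suc-injective len
    join : ∀ R → FirstStep x y R × Arrives m y R → Arrives (suc m) x (y ∷ R)
    join []      ((e , _)  , w , nb , l , len) = (e , w) , tt , l , cong suc len
    join (z ∷ R) ((e , ne) , w , nb , l , len) = (e , w) , (ne , nb) , l , cong suc len

  out-degree : ∀ x → ∑[ y ← vertices ] 𝟙 (Adj? x y) ≡ k
  out-degree x = trans (sym (count≡∑𝟙 (adj G x) vertices)) (regular x)

  in-degree : ∀ y → ∑[ x ← vertices ] 𝟙 (Adj? x y) ≡ k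
  in-degree y = trans (∑-cong vertices (λ x → 𝟙-cong Adj-sym Adj-sym (Adj? x y) (Adj? y x))) (out-degree y)

  in-degree-avoiding : ∀ y z → Adj y z → ∑[ x ← vertices ] 𝟙 (Adj? x y ×-dec ¬? (x ≟ z)) ≡ k ∸ 1
  in-degree-avoiding y z y~z =
    trans (∑-𝟙-except (Uniqueₚ.allFin⁺ n) (∈-allFin z) (λ x → Adj? x y) (_≟ z) (Adj-sym y~z) refl (λ _ → id))
          (cong (_∸ 1) (in-degree y))

  branching : ℕ → ℕ
  branching zero    = k
  branching (suc _) = k ∸ 1

  first-steps : ∀ m y R → (∑[ x ← vertices ] 𝟙 (FirstStep? x y R)) * 𝟙 (Arrives? m y R) ≡
                          branching m * 𝟙 (Arrives? m y R)
  first-steps m y R = *-𝟙-cong (Arrives? m y R) (choices m R)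
    where
    choices : ∀ m R → Arrives m y R → ∑[ x ← vertices ] 𝟙 (FirstStep? x y R) ≡ branching m
    choices zero    []      _               =
      trans (∑-cong vertices (λ x → 𝟙-cong proj₁ (_, tt) (FirstStep? x y []) (Adj? x y))) (in-degree y)
    choices (suc m) (z ∷ R) ((y~z , _) , _) = in-degree-avoiding y z y~z

  arrivals : ℕ → ℕ
  arrivals m = ∑[ w ← vertices ] ∑[ A ← sequences m ] 𝟙 (Arrives? m w A)

  arrivals-zero : arrivals 0 ≡ 1
  arrivals-zero = trans (∑-cong vertices (λ w → +-identityʳ _))
    (trans (∑-single (Uniqueₚ.allFin⁺ n) (∈-allFin v)
                     (λ w w≢v → 𝟙-false (w≢v ∘ proj₁ ∘ proj₂ ∘ proj₂) (Arrives? 0 w [])))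
           (𝟙-true (tt , tt , refl , refl) (Arrives? 0 v [])))

  arrivals-suc : ∀ m → arrivals (suc m) ≡ branching m * arrivals m
  arrivals-suc m = begin
    arrivals (suc m)
      ≡⟨ ∑-cong vertices (λ x → ∑-allLists-∷ n m _) ⟩
    ∑[ x ← vertices ] ∑[ y ← vertices ] ∑[ R ← sequences m ] 𝟙 (Arrives? (suc m) x (y ∷ R))
      ≡⟨ ∑-cong vertices (λ x → ∑-cong vertices (λ y → ∑-cong (sequences m) (Arrives-∷ m x y))) ⟩
    ∑[ x ← vertices ] ∑[ y ← vertices ] ∑[ R ← sequences m ] 𝟙 (FirstStep? x y R) * 𝟙 (Arrives? m y R)
      ≡⟨ ∑-swap vertices vertices _ ⟩
    ∑[ y ← vertices ] ∑[ x ← vertices ] ∑[ R ← sequences m ] 𝟙 (FirstStep? x y R) * 𝟙 (Arrives? m y R)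
      ≡⟨ ∑-cong vertices (λ y → ∑-swap vertices (sequences m) _) ⟩
    ∑[ y ← vertices ] ∑[ R ← sequences m ] ∑[ x ← vertices ] 𝟙 (FirstStep? x y R) * 𝟙 (Arrives? m y R)
      ≡⟨ ∑-cong vertices (λ y → ∑-cong (sequences m) (λ R →
           trans (∑-*ʳ vertices _ _) (first-steps m y R))) ⟩
    ∑[ y ← vertices ] ∑[ R ← sequences m ] branching m * 𝟙 (Arrives? m y R)
      ≡⟨ ∑-cong vertices (λ y → ∑-*ˡ (sequences m) (branching m) _) ⟩
    ∑[ y ← vertices ] branching m * (∑[ R ← sequences m ] 𝟙 (Arrives? m y R))
      ≡⟨ ∑-*ˡ vertices (branching m) _ ⟩
    branching m * arrivals m ∎
    where open ≡-Reasoning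

  arrivals-count : ∀ m → arrivals (suc m) ≡ k * (k ∸ 1) ^ m
  arrivals-count zero    = trans (arrivals-suc 0) (cong (k *_) arrivals-zero)
  arrivals-count (suc m) = begin
    arrivals (suc (suc m))        ≡⟨ arrivals-suc (suc m) ⟩
    (k ∸ 1) * arrivals (suc m)    ≡⟨ cong ((k ∸ 1) *_) (arrivals-count m) ⟩
    (k ∸ 1) * (k * (k ∸ 1) ^ m)   ≡⟨ x∙yz≈y∙xz (k ∸ 1) k _ ⟩
    k * ((k ∸ 1) * (k ∸ 1) ^ m)   ∎
    where open ≡-Reasoning

  -- The girth is g = 2s with s = r + 2.
  module Antipodal (r : ℕ) (no-short-cycle : ∀ m → m < 2 * (2 + r) → ¬ HasCycle G m) where
    open NoShortCycles (2 * (2 + r)) no-short-cycle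

    t s g : ℕ
    t = suc r
    s = suc t
    g = 2 * s

    walkCount : V → ℕ
    walkCount w = ∑[ A ← sequences s ] 𝟙 (Arrives? s w A)

    ∑-walkCount : ∑[ w ← vertices ] walkCount w ≡ k * (k ∸ 1) ^ t
    ∑-walkCount = arrivals-count t

    k∣∑-walkCount : k ∣ ∑[ w ← vertices ] walkCount w
    k∣∑-walkCount = subst (k ∣_) (sym ∑-walkCount) (m∣m*n _)

    arrivals-same-first-step : ∀ {w a R₁ R₂} → Arrives s w (a ∷ R₁) → Arrives s w (a ∷ R₂) → R₁ ≡ R₂
    arrivals-same-first-step {a = a} {R₁} {R₂} ((_ , w₁) , nb₁ , l₁ , |aR₁|) ((_ , w₂) , nb₂ , l₂ , |aR₂|) =
      short-walks-coincide a R₁ R₂ w₁ (NonBacktracking-tail _ nb₁) w₂ (NonBacktracking-tail _ nb₂)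
        (trans l₁ (sym l₂)) (subst₂ (λ p q → p + q < g) (sym (suc-injective |aR₁|)) (sym (suc-injective |aR₂|)) t+t<g)
      where
      t+t<g : t + t < g
      t+t<g = s≤s (+-monoʳ-≤ t (≤-trans (n≤1+n t) (≤-reflexive (sym (+-identityʳ s)))))

    walkCount≤k : ∀ w → walkCount w ≤ k
    walkCount≤k w = begin
      walkCount w                                                     ≡⟨ ∑-allLists-∷ n t _ ⟩
      ∑[ u ← vertices ] ∑[ R ← sequences t ] 𝟙 (Arrives? s w (u ∷ R))
                                                                      ≤⟨ ∑-mono-≤ vertices (via ∘ Adj? w) ⟩
      ∑[ u ← vertices ] 𝟙 (Adj? w u)                                  ≡⟨ out-degree w ⟩
      k                                                               ∎
      where
      open ≤-Reasoning
      via : ∀ {u} (w~u : Dec (Adj w u)) → ∑[ R ← sequences t ] 𝟙 (Arrives? s w (u ∷ R)) ≤ 𝟙 w~u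
      via {u} (no ¬w~u) =
        ≤-reflexive (∑-zero-∈ (sequences t) λ _ → 𝟙-false (¬w~u ∘ proj₁ ∘ proj₁) (Arrives? s w (u ∷ _)))
      via {u} (yes _) = ∑-≤1 (allLists-unique n t) (λ R → 𝟙≤1 (Arrives? s w (u ∷ R)))
        (λ p q → arrivals-same-first-step (𝟙-positive (Arrives? s w _) p) (𝟙-positive (Arrives? s w _) q))

    SameHead : List V → List V → Set
    SameHead (a ∷ _) (b ∷ _) = a ≡ b
    SameHead _       _       = ⊤

    SameHead? : ∀ A₁ A₂ → Dec (SameHead A₁ A₂)
    SameHead? (a ∷ _) (b ∷ _) = a ≟ b
    SameHead? []      _       = yes tt
    SameHead? (_ ∷ _) []      = yes tt

    SameHead-sym : ∀ A₁ A₂ → SameHead A₁ A₂ → SameHead A₂ A₁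
    SameHead-sym (a ∷ _) (b ∷ _) = sym
    SameHead-sym []      []      = id
    SameHead-sym []      (_ ∷ _) = id
    SameHead-sym (_ ∷ _) []      = id

    Partner : V → List V → List V → Set
    Partner w A₁ A₂ = Arrives s w A₂ × ¬ SameHead A₁ A₂

    Partner? : ∀ w A₁ A₂ → Dec (Partner w A₁ A₂)
    Partner? w A₁ A₂ = Arrives? s w A₂ ×-dec ¬? (SameHead? A₁ A₂)

    Fork : V → List V → List V → Set
    Fork w A₁ A₂ = Arrives s w A₁ × Partner w A₁ A₂

    Fork? : ∀ w A₁ A₂ → Dec (Fork w A₁ A₂)
    Fork? w A₁ A₂ = Arrives? s w A₁ ×-dec Partner? w A₁ A₂

    Fork-sym : ∀ {w A₁ A₂} → Fork w A₁ A₂ → Fork w A₂ A₁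
    Fork-sym {A₁ = A₁} {A₂} (arr₁ , arr₂ , heads≢) = arr₂ , arr₁ , heads≢ ∘ SameHead-sym A₂ A₁

    same-head⇒equal : ∀ {w} A₁ A₂ → Arrives s w A₁ → Arrives s w A₂ → SameHead A₁ A₂ → A₂ ≡ A₁
    same-head⇒equal (a ∷ _) (.a ∷ _) arr₁ arr₂ refl = cong (a ∷_) (arrivals-same-first-step arr₂ arr₁)

    partners : ∀ {w A₁} → Arrives s w A₁ → ∑[ A₂ ← sequences s ] 𝟙 (Partner? w A₁ A₂) ≡ walkCount w ∸ 1
    partners {A₁ = A₁} arr₁@(_ , _ , _ , |A₁|) =
      ∑-𝟙-except (allLists-unique n s) (∈-allLists n A₁ |A₁|) (Arrives? s _) (SameHead? A₁)
                 arr₁ (SameHead-refl A₁ arr₁) (same-head⇒equal A₁ _ arr₁)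
      where
      SameHead-refl : ∀ {w} A → Arrives s w A → SameHead A A
      SameHead-refl (a ∷ _) _ = refl

    ∑Pairs : (V → List V → List V → ℕ) → ℕ
    ∑Pairs F = ∑[ w ← vertices ] ∑[ A₁ ← sequences s ] ∑[ A₂ ← sequences s ] F w A₁ A₂

    fork : V → List V → List V → ℕ
    fork w A₁ A₂ = 𝟙 (Fork? w A₁ A₂)

    ∑Pairs-fork : ∑Pairs fork ≡ ∑[ w ← vertices ] walkCount w * (walkCount w ∸ 1)
    ∑Pairs-fork = ∑-cong vertices λ w → begin
      ∑[ A₁ ← sequences s ] ∑[ A₂ ← sequences s ] fork w A₁ A₂
        ≡⟨ ∑-cong (sequences s) (λ A₁ → ∑-cong (sequences s) (λ A₂ →
             𝟙-× (Arrives? s w A₁) (Partner? w A₁ A₂))) ⟩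
      ∑[ A₁ ← sequences s ] ∑[ A₂ ← sequences s ] 𝟙 (Arrives? s w A₁) * 𝟙 (Partner? w A₁ A₂)
        ≡⟨ ∑-cong (sequences s) (λ A₁ → ∑-*ˡ (sequences s) (𝟙 (Arrives? s w A₁)) _) ⟩
      ∑[ A₁ ← sequences s ] 𝟙 (Arrives? s w A₁) * (∑[ A₂ ← sequences s ] 𝟙 (Partner? w A₁ A₂))
        ≡⟨ ∑-cong (sequences s) (λ A₁ → trans (*-comm (𝟙 (Arrives? s w A₁)) _)
                                                 (*-𝟙-cong (Arrives? s w A₁) partners)) ⟩
      ∑[ A₁ ← sequences s ] (walkCount w ∸ 1) * 𝟙 (Arrives? s w A₁)
        ≡⟨ ∑-cong (sequences s) (λ A₁ → *-comm (walkCount w ∸ 1) _) ⟩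
      ∑[ A₁ ← sequences s ] 𝟙 (Arrives? s w A₁) * (walkCount w ∸ 1)
        ≡⟨ ∑-*ʳ (sequences s) _ (walkCount w ∸ 1) ⟩
      walkCount w * (walkCount w ∸ 1) ∎
      where open ≡-Reasoning

    ∑Split : (V → List V → V → List V → ℕ) → ℕ
    ∑Split F = ∑[ x₀ ← vertices ] ∑[ δ₁ ← sequences t ] ∑[ w ← vertices ] ∑[ δ₂ ← sequences t ]
                 F x₀ δ₁ w δ₂

    ∑Split-cong : ∀ F H →
                  (∀ x₀ δ₁ w δ₂ → length δ₁ ≡ t → length δ₂ ≡ t → F x₀ δ₁ w δ₂ ≡ H x₀ δ₁ w δ₂) →
                  ∑Split F ≡ ∑Split H
    ∑Split-cong F H e =
      ∑-cong vertices λ x₀ → ∑-cong-∈ (sequences t) λ δ₁∈ →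
      ∑-cong vertices λ w  → ∑-cong-∈ (sequences t) λ δ₂∈ →
        e x₀ _ w _ (∈-allLists⇒length n t δ₁∈) (∈-allLists⇒length n t δ₂∈)

    ∑Split-+ : ∀ F H →
               ∑Split (λ x₀ δ₁ w δ₂ → F x₀ δ₁ w δ₂ + H x₀ δ₁ w δ₂) ≡ ∑Split F + ∑Split H
    ∑Split-+ F H =
      trans (∑-cong vertices λ x₀ →
               trans (∑-cong (sequences t) λ δ₁ →
                        trans (∑-cong vertices λ w → ∑-+ (sequences t) _ _) (∑-+ vertices _ _))
                     (∑-+ (sequences t) _ _))
            (∑-+ vertices _ _)

    ∑-cycleSequences : ∀ f → ∑ (sequences g) f ≡ ∑Split (λ x₀ δ₁ w δ₂ → f (x₀ ∷ δ₁ ++ w ∷ δ₂))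
    ∑-cycleSequences f = begin
      ∑ (sequences g) f
        ≡⟨ cong (λ m → ∑ (sequences m) f) g≡ ⟩
      ∑ (sequences (suc (t + suc t))) f
        ≡⟨ ∑-allLists-∷ n (t + suc t) f ⟩
      ∑[ x₀ ← vertices ] ∑[ ρ ← sequences (t + suc t) ] f (x₀ ∷ ρ)
        ≡⟨ ∑-cong vertices (λ x₀ → ∑-allLists-++ n t (suc t) _) ⟩
      ∑[ x₀ ← vertices ] ∑[ δ₁ ← sequences t ] ∑[ ρ ← sequences (suc t) ] f (x₀ ∷ δ₁ ++ ρ)
        ≡⟨ ∑-cong vertices (λ x₀ → ∑-cong (sequences t) (λ δ₁ → ∑-allLists-∷ n t _)) ⟩
      ∑Split (λ x₀ δ₁ w δ₂ → f (x₀ ∷ δ₁ ++ w ∷ δ₂)) ∎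
      where
      open ≡-Reasoning
      g≡ : g ≡ suc (t + suc t)
      g≡ = cong (λ m → suc (t + m)) (+-identityʳ (suc t))

    onHalves : (V → List V → List V → ℕ) → V → List V → V → List V → ℕ
    onHalves F x₀ δ₁ w δ₂ = F w (reverse (x₀ ∷ δ₁)) (δ₂ ∷ʳ x₀)

    -- Only pairs of walks with a common endpoint x₀ contribute; splitting off that endpoint
    -- and reversing the first walk turns them into the two halves of a closed sequence through x₀.
    ∑Pairs-as-∑Split : ∀ F → (∀ w A₁ A₂ → lastOr w A₁ ≢ lastOr w A₂ → F w A₁ A₂ ≡ 0) →
                       ∑Pairs F ≡ ∑Split (onHalves F)
    ∑Pairs-as-∑Split F vanish = begin
      ∑[ w ← vertices ] ∑[ A₁ ← sequences s ] ∑[ A₂ ← sequences s ] F w A₁ A₂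
        ≡⟨ ∑-cong vertices (λ w → ∑-cong (sequences s) (λ A₁ → ∑-allLists-∷ʳ n t _)) ⟩
      ∑[ w ← vertices ] ∑[ A₁ ← sequences s ] ∑[ δ₂ ← sequences t ] ∑[ z ← vertices ] F w A₁ (δ₂ ∷ʳ z)
        ≡⟨ ∑-cong vertices (λ w → ∑-cong (sequences s) (λ A₁ → ∑-cong (sequences t) (λ δ₂ →
             ∑-single (Uniqueₚ.allFin⁺ n) (∈-allFin (lastOr w A₁))
               (λ z z≢ → vanish w A₁ (δ₂ ∷ʳ z) (λ e → z≢ (sym (trans e (lastOr-∷ʳ w δ₂ z)))))))) ⟩
      ∑[ w ← vertices ] ∑[ A₁ ← sequences s ] ∑[ δ₂ ← sequences t ] F w A₁ (δ₂ ∷ʳ lastOr w A₁)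
        ≡⟨ ∑-cong vertices (λ w → ∑-allLists-reverse n s _) ⟩
      ∑[ w ← vertices ] ∑[ B ← sequences s ] ∑[ δ₂ ← sequences t ]
        F w (reverse B) (δ₂ ∷ʳ lastOr w (reverse B))
        ≡⟨ ∑-cong vertices (λ w → ∑-allLists-∷ n t _) ⟩
      ∑[ w ← vertices ] ∑[ x₀ ← vertices ] ∑[ δ₁ ← sequences t ] ∑[ δ₂ ← sequences t ]
        F w (reverse (x₀ ∷ δ₁)) (δ₂ ∷ʳ lastOr w (reverse (x₀ ∷ δ₁)))
        ≡⟨ ∑-cong vertices (λ w → ∑-cong vertices (λ x₀ → ∑-cong (sequences t) (λ δ₁ → ∑-cong (sequences t) (λ δ₂ →
             cong (λ z → F w (reverse (x₀ ∷ δ₁)) (δ₂ ∷ʳ z)) (lastOr-reverse w x₀ δ₁))))) ⟩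
      ∑[ w ← vertices ] ∑[ x₀ ← vertices ] ∑[ δ₁ ← sequences t ] ∑[ δ₂ ← sequences t ]
        onHalves F x₀ δ₁ w δ₂
        ≡⟨ ∑-swap vertices vertices _ ⟩
      ∑[ x₀ ← vertices ] ∑[ w ← vertices ] ∑[ δ₁ ← sequences t ] ∑[ δ₂ ← sequences t ]
        onHalves F x₀ δ₁ w δ₂
        ≡⟨ ∑-cong vertices (λ x₀ → ∑-swap vertices (sequences t) _) ⟩
      ∑Split (onHalves F) ∎
      where open ≡-Reasoning

    -- The penultimate vertices of the two walks are the neighbours of v on the cycle, so this is
    -- the orientation condition toℕ v₁ < toℕ v_{m-1} of isCanonicalCycleAt.
    Before : V → List V → List V → Set
    Before w A₁ A₂ = toℕ (penultimateOr w A₁) < toℕ (penultimateOr w A₂)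

    Before? : ∀ w A₁ A₂ → Dec (Before w A₁ A₂)
    Before? w A₁ A₂ = toℕ (penultimateOr w A₁) ℕ.<? toℕ (penultimateOr w A₂)

    forkBefore forkAfter : V → List V → List V → ℕ
    forkBefore w A₁ A₂ = 𝟙 (Fork? w A₁ A₂ ×-dec Before? w A₁ A₂)
    forkAfter  w A₁ A₂ = 𝟙 (Fork? w A₁ A₂ ×-dec Before? w A₂ A₁)

    -- A closed sequence x₀ ∷ y ∷ δ₁ ++ w ∷ z ∷ δ₂ of length g splits at its antipode w into the
    -- walks A₁ = reverse (x₀ ∷ y ∷ δ₁) and A₂ = z ∷ δ₂ ∷ʳ x₀ from w to x₀.
    module CycleThrough (x₀ y : V) (δ₁ : List V) (w z : V) (δ₂ : List V)
                        (|yδ₁| : length (y ∷ δ₁) ≡ t) (|zδ₂| : length (z ∷ δ₂) ≡ t) where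

      P Q xs A₁ A₂ : List V
      P  = x₀ ∷ y ∷ δ₁
      Q  = z ∷ δ₂
      xs = P ++ w ∷ Q
      A₁ = reverse P
      A₂ = Q ∷ʳ x₀

      private
        reverse-P∷ʳw : reverse (P ∷ʳ w) ≡ w ∷ A₁
        reverse-P∷ʳw = reverse-++ P (w ∷ [])
        ℓ = lastOr y δ₁
        Y = proj₁ (init-last x₀ (y ∷ δ₁))
        P≡Y∷ʳℓ : P ≡ Y ∷ʳ ℓ
        P≡Y∷ʳℓ = proj₂ (init-last x₀ (y ∷ δ₁))
        A₁≡ : A₁ ≡ ℓ ∷ reverse Y
        A₁≡ = trans (cong reverse P≡Y∷ʳℓ) (reverse-++ Y (ℓ ∷ []))
        |A₁| : length A₁ ≡ s
        |A₁| = trans (length-reverse P) (cong suc |yδ₁|)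
        |A₂| : length A₂ ≡ s
        |A₂| = trans (length-++ Q) (trans (+-comm (length Q) 1) (cong suc |zδ₂|))
        |xs| : length xs ≤ g
        |xs| = ≤-reflexive (trans (length-++ P)
                 (cong₂ (λ a b → suc a + suc b) |yδ₁| (trans |zδ₂| (sym (+-identityʳ t)))))

      cycle⇒fork : x₀ ≡ v → Unique xs → Walk (xs ∷ʳ x₀) → Fork w A₁ A₂
      cycle⇒fork x₀≡v !xs closed =
        (walk₁ , nb₁ , trans (lastOr-reverse w x₀ (y ∷ δ₁)) x₀≡v , |A₁|) ,
        (walk₂ , nb₂ , trans (lastOr-∷ʳ w Q x₀) x₀≡v , |A₂|) ,
        subst (λ A → ¬ SameHead A A₂) (sym A₁≡) ℓ≢z
        where
        walk₁ : Walk (w ∷ A₁)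
        walk₁ = subst Walk reverse-P∷ʳw (Walk-reverse (P ∷ʳ w) (Walk-++⁻ˡ (P ∷ʳ w)
          (subst Walk (trans (++-assoc P (w ∷ Q) (x₀ ∷ [])) (sym (++-assoc P (w ∷ []) A₂))) closed)))
        nb₁ : NonBacktracking (w ∷ A₁)
        nb₁ = subst NonBacktracking reverse-P∷ʳw (NonBacktracking-reverse _ (Unique⇒NonBacktracking _
          (Unique-++⁻ˡ (P ∷ʳ w) (subst Unique (sym (++-assoc P (w ∷ []) Q)) !xs))))
        walk₂ : Walk (w ∷ A₂)
        walk₂ = Walk-++⁻ʳ P (subst Walk (++-assoc P (w ∷ Q) (x₀ ∷ [])) closed)
        nb₂ : NonBacktracking (w ∷ A₂)
        nb₂ = Unique⇒NonBacktracking _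
          (Unique-∷ʳ (Unique-++⁻ʳ P !xs) (proj₂ (Allₚ.++⁻ (y ∷ δ₁) (AllPairs.head !xs))))
        ℓ≢z : ℓ ≢ z
        ℓ≢z = All.head (All.tail (AllPairs.head (Unique-++⁻ʳ Y
          (subst Unique (trans (cong (_++ w ∷ Q) P≡Y∷ʳℓ) (++-assoc Y (ℓ ∷ []) (w ∷ Q))) !xs))))

      fork⇒cycle : Fork w A₁ A₂ → x₀ ≡ v × Unique xs × Walk (xs ∷ʳ x₀)
      fork⇒cycle ((walk₁ , nb₁ , last₁ , _) , (walk₂ , nb₂ , _) , heads≢) =
        trans (sym (lastOr-reverse w x₀ (y ∷ δ₁))) last₁ ,
        short-nonBacktracking⇒Unique xs (Walk-++⁻ˡ xs closed) (NonBacktracking-++⁻ˡ xs nb-closed) |xs| ,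
        closed
        where
        closed≡ : xs ∷ʳ x₀ ≡ P ++ w ∷ A₂
        closed≡ = ++-assoc P (w ∷ Q) (x₀ ∷ [])
        walkP : Walk (P ∷ʳ w)
        walkP = subst Walk (reverse-involutive (P ∷ʳ w)) (Walk-reverse _ (subst Walk (sym reverse-P∷ʳw) walk₁))
        nbP : NonBacktracking (P ∷ʳ w)
        nbP = subst NonBacktracking (reverse-involutive (P ∷ʳ w))
          (NonBacktracking-reverse _ (subst NonBacktracking (sym reverse-P∷ʳw) nb₁))
        closed : Walk (xs ∷ʳ x₀)
        closed = subst Walk (sym closed≡) (Walk-join P w A₂ walkP walk₂)
        nb-closed : NonBacktracking (xs ∷ʳ x₀)
        nb-closed = subst NonBacktracking (sym closed≡)
          (NonBacktracking-join P w A₂ nbP nb₂ (subst (λ A → ¬ SameHead A A₂) A₁≡ heads≢))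

      private
        penultimate₁ : penultimateOr w A₁ ≡ y
        penultimate₁ = trans (cong (penultimateOr w) (unfold-reverse x₀ (y ∷ δ₁)))
                             (trans (penultimateOr-∷ʳ w (reverse (y ∷ δ₁)) x₀) (lastOr-reverse w y δ₁))
        penultimate₂ : penultimateOr w A₂ ≡ lastOr w Q
        penultimate₂ = penultimateOr-∷ʳ w Q x₀
        Before≡ : Before w A₁ A₂ ≡ (toℕ y < toℕ (lastOr y (δ₁ ++ w ∷ Q)))
        Before≡ = cong₂ (λ a b → toℕ a < toℕ b) penultimate₁
                        (trans penultimate₂ (sym (lastOr-++-∷ y δ₁ w Q)))

      canonical⇔forkBefore : 𝟙 (isCanonicalCycleAt G v xs Bool.≟ true) ≡ forkBefore w A₁ A₂
      canonical⇔forkBefore =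
        𝟙-cong to from (isCanonicalCycleAt G v xs Bool.≟ true) (Fork? w A₁ A₂ ×-dec Before? w A₁ A₂)
        where
        to : isCanonicalCycleAt G v xs ≡ true → Fork w A₁ A₂ × Before w A₁ A₂
        to e =
          let at-v , rest        = ∧-true⁻ {⌊ x₀ ≟ v ⌋} e
              is-cycle , ordered = ∧-true⁻ {isCycleSeq G xs} rest
              !xs , closed       = isCycleSeq⇒closedPath x₀ (y ∷ δ₁ ++ w ∷ Q) is-cycle
          in cycle⇒fork (toWitness (subst T (sym at-v) tt)) !xs closed ,
             subst id (sym Before≡) (<ᵇ⇒< _ _ (subst T (sym ordered) tt))
        from : Fork w A₁ A₂ × Before w A₁ A₂ → isCanonicalCycleAt G v xs ≡ true
        from (fork , before) =
          let x₀≡v , !xs , closed = fork⇒cycle fork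
          in ∧-true⁺ (Equivalence.to Bool.T-≡ (fromWitness {a? = x₀ ≟ v} x₀≡v))
                     (∧-true⁺ (closedPath⇒isCycleSeq x₀ y δ₁ w Q !xs closed)
                              (Equivalence.to Bool.T-≡ (<⇒<ᵇ (subst id Before≡ before))))

      fork-orientations : fork w A₁ A₂ ≡ forkBefore w A₁ A₂ + forkAfter w A₁ A₂
      fork-orientations = trans (𝟙-split (Fork? w A₁ A₂) (Before? w A₁ A₂))
        (cong (forkBefore w A₁ A₂ +_)
              (𝟙-cong to from (Fork? w A₁ A₂ ×-dec ¬? (Before? w A₁ A₂)) (Fork? w A₁ A₂ ×-dec Before? w A₂ A₁)))
        where
        penultimates-differ : Fork w A₁ A₂ → toℕ (penultimateOr w A₂) ≢ toℕ (penultimateOr w A₁)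
        penultimates-differ fork e =
          let _ , !xs , _ = fork⇒cycle fork
          in lastOr-∉ w Q (Allₚ.++⁻ʳ δ₁ (AllPairs.head (AllPairs.tail !xs)))
                          (trans (sym penultimate₂) (trans (toℕ-injective e) penultimate₁))
        to : Fork w A₁ A₂ × ¬ Before w A₁ A₂ → Fork w A₁ A₂ × Before w A₂ A₁
        to (fork , ¬before) = fork , ≤∧≢⇒< (≮⇒≥ ¬before) (penultimates-differ fork)
        from : Fork w A₁ A₂ × Before w A₂ A₁ → Fork w A₁ A₂ × ¬ Before w A₁ A₂
        from (fork , after) = fork , <-asym after



    Fork⇒same-end : ∀ {w A₁ A₂} → Fork w A₁ A₂ → lastOr w A₁ ≡ lastOr w A₂
    Fork⇒same-end ((_ , _ , last₁ , _) , (_ , _ , last₂ , _) , _) = trans last₁ (sym last₂)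

    forkBefore⇒Fork : ∀ {w A₁ A₂} → 0 < forkBefore w A₁ A₂ → Fork w A₁ A₂
    forkBefore⇒Fork {w} {A₁} {A₂} = proj₁ ∘ 𝟙-positive (Fork? w A₁ A₂ ×-dec Before? w A₁ A₂)

    forkAfter⇒Fork : ∀ {w A₁ A₂} → 0 < forkAfter w A₁ A₂ → Fork w A₁ A₂
    forkAfter⇒Fork {w} {A₁} {A₂} = proj₁ ∘ 𝟙-positive (Fork? w A₁ A₂ ×-dec Before? w A₂ A₁)

    ∑Pairs-on-forks : ∀ F → (∀ {w A₁ A₂} → 0 < F w A₁ A₂ → Fork w A₁ A₂) →
                      ∑Pairs F ≡ ∑Split (onHalves F)
    ∑Pairs-on-forks F only-forks =
      ∑Pairs-as-∑Split F λ w A₁ A₂ ends≢ → n≤0⇒n≡0 (≮⇒≥ (ends≢ ∘ Fork⇒same-end ∘ only-forks))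

    cyclesThrough≡∑Pairs-forkBefore : cyclesThrough G g v ≡ ∑Pairs forkBefore
    cyclesThrough≡∑Pairs-forkBefore = begin
      cyclesThrough G g v
        ≡⟨ count≡∑𝟙 (isCanonicalCycleAt G v) (sequences g) ⟩
      ∑[ xs ← sequences g ] 𝟙 (isCanonicalCycleAt G v xs Bool.≟ true)
        ≡⟨ ∑-cycleSequences _ ⟩
      ∑Split (λ x₀ δ₁ w δ₂ → 𝟙 (isCanonicalCycleAt G v (x₀ ∷ δ₁ ++ w ∷ δ₂) Bool.≟ true))
        ≡⟨ ∑Split-cong _ _ (λ { x₀ (y ∷ δ₁) w (z ∷ δ₂) →
             CycleThrough.canonical⇔forkBefore x₀ y δ₁ w z δ₂ }) ⟩
      ∑Split (onHalves forkBefore)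
        ≡⟨ ∑Pairs-on-forks forkBefore forkBefore⇒Fork ⟨
      ∑Pairs forkBefore ∎
      where open ≡-Reasoning

    ∑Pairs-fork≡forkBefore+forkAfter : ∑Pairs fork ≡ ∑Pairs forkBefore + ∑Pairs forkAfter
    ∑Pairs-fork≡forkBefore+forkAfter = begin
      ∑Pairs fork
        ≡⟨ ∑Pairs-on-forks fork (λ {w} {A₁} {A₂} → 𝟙-positive (Fork? w A₁ A₂)) ⟩
      ∑Split (onHalves fork)
        ≡⟨ ∑Split-cong _ _ (λ { x₀ (y ∷ δ₁) w (z ∷ δ₂) →
             CycleThrough.fork-orientations x₀ y δ₁ w z δ₂ }) ⟩
      ∑Split (λ x₀ δ₁ w δ₂ → onHalves forkBefore x₀ δ₁ w δ₂ + onHalves forkAfter x₀ δ₁ w δ₂)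
        ≡⟨ ∑Split-+ _ _ ⟩
      ∑Split (onHalves forkBefore) + ∑Split (onHalves forkAfter)
        ≡⟨ cong₂ _+_ (∑Pairs-on-forks forkBefore forkBefore⇒Fork) (∑Pairs-on-forks forkAfter forkAfter⇒Fork) ⟨
      ∑Pairs forkBefore + ∑Pairs forkAfter ∎
      where open ≡-Reasoning

    ∑Pairs-forkAfter≡forkBefore : ∑Pairs forkAfter ≡ ∑Pairs forkBefore
    ∑Pairs-forkAfter≡forkBefore = ∑-cong vertices λ w →
      trans (∑-cong (sequences s) λ A₁ → ∑-cong (sequences s) λ A₂ →
               𝟙-cong (map₁ Fork-sym) (map₁ Fork-sym)
                      (Fork? w A₁ A₂ ×-dec Before? w A₂ A₁) (Fork? w A₂ A₁ ×-dec Before? w A₂ A₁))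
            (∑-swap (sequences s) (sequences s) (λ A₁ A₂ → forkBefore w A₂ A₁))

    ∑Pairs-fork≡2·cyclesThrough : ∑Pairs fork ≡ cyclesThrough G g v + cyclesThrough G g v
    ∑Pairs-fork≡2·cyclesThrough = begin
      ∑Pairs fork                              ≡⟨ ∑Pairs-fork≡forkBefore+forkAfter ⟩
      ∑Pairs forkBefore + ∑Pairs forkAfter     ≡⟨ cong (∑Pairs forkBefore +_) ∑Pairs-forkAfter≡forkBefore ⟩
      ∑Pairs forkBefore + ∑Pairs forkBefore    ≡⟨ cong₂ _+_ cyclesThrough≡∑Pairs-forkBefore
                                                               cyclesThrough≡∑Pairs-forkBefore ⟨
      cyclesThrough G g v + cyclesThrough G g v ∎
      where open ≡-Reasoning

    open Defect k walkCount walkCount≤k public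

    cycles-handshake : cyclesThrough G g v + cyclesThrough G g v + defect vertices ≡ k * (k ∸ 1) ^ s
    cycles-handshake = begin
      cyclesThrough G g v + cyclesThrough G g v + defect vertices
        ≡⟨ cong (_+ defect vertices) (trans (sym ∑Pairs-fork≡2·cyclesThrough) ∑Pairs-fork) ⟩
      (∑[ w ← vertices ] walkCount w * (walkCount w ∸ 1)) + (∑[ w ← vertices ] walkCount w * (k ∸ walkCount w))
        ≡⟨ ∑-+ vertices _ _ ⟨
      ∑[ w ← vertices ] (walkCount w * (walkCount w ∸ 1) + walkCount w * (k ∸ walkCount w))
        ≡⟨ ∑-cong vertices (λ w → *-∸-split (walkCount≤k w)) ⟩
      ∑[ w ← vertices ] walkCount w * (k ∸ 1)
        ≡⟨ ∑-*ʳ vertices walkCount (k ∸ 1) ⟩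
      (∑[ w ← vertices ] walkCount w) * (k ∸ 1)
        ≡⟨ cong (_* (k ∸ 1)) ∑-walkCount ⟩
      k * (k ∸ 1) ^ t * (k ∸ 1)
        ≡⟨ *-assoc k _ (k ∸ 1) ⟩
      k * ((k ∸ 1) ^ t * (k ∸ 1))
        ≡⟨ cong (k *_) (*-comm ((k ∸ 1) ^ t) (k ∸ 1)) ⟩
      k * (k ∸ 1) ^ s ∎
      where open ≡-Reasoning

theorem11 : (k s ε : ℕ) → 3 ≤ k → 4 ≤ 2 * s → 0 < ε → ε < k ∸ 1 →
    ¬ (Σ ℕ λ n → Σ (Graph n) λ G → IsVGR G k (2 * s) (nc k s ∸ ε))
theorem11 _ zero          _ _ ()
theorem11 _ (suc zero)    _ _ (s≤s (s≤s ()))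
theorem11 _ (suc (suc _)) _ _ _ _ _ (_ , _ , _ , (([] , () , _) , _) , _)
theorem11 k (suc (suc r)) ε 3≤k _ ε>0 ε<k-1 (n , G , regular , ((v ∷ _ , _) , no-short-cycle) , λ-regular) =
  let defect>0 , defect≤ = remainder-after-halving M ε _ _ M>0 ε>0 (λ-regular v) cycles-handshake
  in >⇒≢ defect>0 (defect-gap (allFin n) k∣∑-walkCount (≤-<-trans defect≤ (suc-double<double ε<k-1)))
  where
  open Arrivals G k regular v
  open Antipodal r no-short-cycle
  M = k * (k ∸ 1) ^ s
  M>0 : 0 < M
  M>0 = *-mono-≤ (≤-trans (s≤s z≤n) 3≤k) (m^n>0 (k ∸ 1) {{>-nonZero (≤-<-trans z≤n ε<k-1)}} s)
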